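{- Let $\mathcal{G}$ be a rooted temporal tree in which every edge is associated with exactly one time interval, and let $v$ be a non-leaf node with children $u_1,\dots,u_k$. Suppose that for each $i$, $M_{u_i}$ is a maximum 0-1 timed matching for $T_{u_i}$ and there is no 0-1 timed matching $M'_{u_i}$ for $T_{u_i}$ with $|M'_{u_i}|=|M_{u_i}|$ such that $|R_{M'_{u_i}}(e_{vu_i})|=0$ but $|R_{M_{u_i}}(e_{vu_i})|>0$. If the maximum feasible set $F_v$ for $T_v$ is empty, then $|TM1[v]|\ge|\tilde M_v|$, where $TM1[v]=\bigcup_{i}M_{u_i}$ and $\tilde M_v$ is a maximum-cardinality 0-1 timed matching for $T_v$ among those containing at least one edge incident on $v$.
   Context: A temporal graph has a finite node set and a finite edge set; each edge joins two distinct nodes (at most one per pair) and is associated with a nonempty list of time intervals $[s_1,f_1),\dots,[s_k,f_k)$ of integers with $0\le s_1<f_1<s_2<\dots<s_k<f_k\le\mathcal{T}$ ($\mathcal{T}$ the lifetime), existing at each integer timestep in one of them. A rooted temporal tree is a temporal graph whose underlying static graph (edge $\{u,v\}$ per temporal edge) is a tree with a designated root; $P(v)$ is the parent, $child(v)$ the children, $T_v$ the temporal subtree on $v$ and its descendants, and $e_{xy}$ the edge between $x$ and $y$. Two distinct edges overlap if they share an endpoint and exist at a common timestep; a 0-1 timed matching is a set of edges no two of which overlap. For $u_i\in child(v)$ and a 0-1 timed matching $M$ of $T_{u_i}$, the minimum removal set $R_M(e_{vu_i})$ is a minimum-cardinality subset of $M$ whose removal makes $\{e_{vu_i}\}\cup(M\setminus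 R_M(e_{vu_i}))$ a 0-1 timed matching (equivalently, the edges of $M$ overlapping $e_{vu_i}$). Given the $M_{u_i}$, a maximum allowable set for $T_v$ is a maximum-cardinality set $A$ of edges from $v$ to its children such that $A\cup\bigcup_i M_{u_i}$ is a 0-1 timed matching for $T_v$; a maximum feasible set $F_v$ is a maximum allowable set $A$ such that $A\cup\{e_{vP(v)}\}$ is a 0-1 timed matching, if such exists (and $v$ is not the root), and otherwise an arbitrary maximum allowable set. -}

module Defs where

open import Data.Nat using (ℕ; _≤_; _<_)
open import Data.Fin using (Fin)
open import Data.Fin.Properties using (_≟_)
open import Data.Fin.Subset using (Subset; _∈_; _∪_; ⁅_⁆; ⋃; ∣_∣)
open import Data.List using (List; filter; map; allFin)
open import Data.Product using (Σ; ∃; _×_; _,_)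
open import Data.Sum using (_⊎_)
open import Relation.Nullary using (¬_; ¬?)
open import Relation.Nullary.Decidable using (_×-dec_)
open import Relation.Binary.PropositionalEquality using (_≡_; _≢_)

-- Every non-root node x has a parent (par x); the temporal
-- edge e_x = {x , par x} exists exactly at the integer timesteps t with
-- start x ≤ t < fin x, where start x < fin x ≤ lifetime.  The depth function
-- strictly decreasing towards the parent guarantees that the underlying static
-- graph (edges {x , par x}, x ≠ root) is a tree rooted at root.  Every rooted
-- tree with single-interval edges arises this way (edges indexed by their
-- lower endpoint).  par/start/fin of the root are irrelevant.
record RTT (n : ℕ) : Set where
  field
    lifetime  : ℕ
    root      : Fin n
    par       : Fin n → Fin n
    depth     : Fin n → ℕ
    depth-par : ∀ x → x ≢ root → depth (par x) < depth x
    start     : Fin n → ℕ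
    fin       : Fin n → ℕ
    start<fin : ∀ x → x ≢ root → start x < fin x
    fin≤life  : ∀ x → x ≢ root → fin x ≤ lifetime

module _ {n : ℕ} (G : RTT n) where
  open RTT G

  Child : Fin n → Fin n → Set
  Child v u = u ≢ root × par u ≡ v

  children : Fin n → List (Fin n)
  children v = filter (λ u → ¬? (u ≟ root) ×-dec (par u ≟ v)) (allFin n)

  data Desc (u : Fin n) : Fin n → Set where
    here : Desc u u
    step : ∀ {x} → x ≢ root → Desc u (par x) → Desc u x

  EdgeIn : Fin n → Fin n → Set
  EdgeIn u x = x ≢ root × Desc u (par x)

  Active : Fin n → ℕ → Set
  Active x t = start x ≤ t × t < fin x

  ShareEnd : Fin n → Fin n → Set
  ShareEnd x y = x ≡ y ⊎ x ≡ par y ⊎ par x ≡ y ⊎ par x ≡ par y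

  Incident : Fin n → Fin n → Set
  Incident v x = x ≡ v ⊎ par x ≡ v

  Overlap : Fin n → Fin n → Set
  Overlap x y = x ≢ y × ShareEnd x y × ∃ λ t → Active x t × Active y t

  NoOverlap : Subset n → Set
  NoOverlap S = ∀ x y → x ∈ S → y ∈ S → ¬ Overlap x y

  IsTimedMatching : Subset n → Set
  IsTimedMatching S = (∀ x → x ∈ S → x ≢ root) × NoOverlap S

  IsTimedMatchingOf : Fin n → Subset n → Set
  IsTimedMatchingOf u S = (∀ x → x ∈ S → EdgeIn u x) × NoOverlap S

  IsMaxTimedMatchingOf : Fin n → Subset n → Set
  IsMaxTimedMatchingOf u S =
    IsTimedMatchingOf u S × (∀ S' → IsTimedMatchingOf u S' → ∣ S' ∣ ≤ ∣ S ∣)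

  -- membership in the minimum removal set R_M(e_{v u}) = edges of M
  -- overlapping e_{v u} (= e_u since par u = v)
  InRemovalSet : Subset n → Fin n → Fin n → Set
  InRemovalSet M u x = x ∈ M × Overlap x u

  TM1 : (Fin n → Subset n) → Fin n → Subset n
  TM1 M v = ⋃ (map M (children v))

  IsAllowable : (Fin n → Subset n) → Fin n → Subset n → Set
  IsAllowable M v A =
    (∀ x → x ∈ A → Child v x) × IsTimedMatchingOf v (A ∪ TM1 M v)

  IsMaxAllowable : (Fin n → Subset n) → Fin n → Subset n → Set
  IsMaxAllowable M v A =
    IsAllowable M v A × (∀ A' → IsAllowable M v A' → ∣ A' ∣ ≤ ∣ A ∣)

  ParentCompatible : Fin n → Subset n → Set
  ParentCompatible v A = v ≢ root × IsTimedMatching (A ∪ ⁅ v ⁆)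

  IsMaxFeasible : (Fin n → Subset n) → Fin n → Subset n → Set
  IsMaxFeasible M v F =
    IsMaxAllowable M v F ×
    ((∃ λ A → IsMaxAllowable M v A × ParentCompatible v A) → ParentCompatible v F)

  IsMaxIncidentMatching : Fin n → Subset n → Set
  IsMaxIncidentMatching v S =
    (IsTimedMatchingOf v S × ∃ λ x → x ∈ S × Incident v x) ×
    (∀ S' → IsTimedMatchingOf v S' → (∃ λ x → x ∈ S' × Incident v x) → ∣ S' ∣ ≤ ∣ S ∣)

-- Let Mt be any 0-1 timed matching of T_v and split it by the child subtree
-- containing the lower endpoint of each edge: the part for child u consists of
-- a matching N_u of T_u, plus possibly e_{vu} itself.  Then |N_u| ≤ |M_u| by
-- maximality of M_u.  If e_{vu} ∈ Mt, then N_u avoids e_{vu}; were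
-- |N_u| = |M_u|, the hypothesis on M_u would make M_u avoid e_{vu} as well,
-- so {e_{vu}} would be allowable, contradicting |F_v| = 0.  Hence every part
-- has at most |M_u| edges, and the M_u, living in disjoint subtrees, add up
-- to |TM1[v]|.
module Submission where

open import Defs
open import Data.Nat using (ℕ; zero; suc; _+_; _≤_; _<_; z≤n; s≤s)
open import Data.Nat.Properties
  using ( module ≤-Reasoning; ≤-refl; ≤-trans; ≤-reflexive; <⇒≤; <⇒≱; ≤∧≢⇒<; 1+n≰n
        ; m≤n⇒m≤1+n; +-suc; +-comm; +-mono-≤)
open import Data.Nat.ListAction using (sum)
open import Data.Nat.Induction using (<-wellFounded)
open import Data.Fin using (Fin; zero; suc)
open import Data.Fin.Properties using (_≟_)
open import Data.Fin.Subset
  using (Subset; inside; outside; _∈_; _⊆_; _∪_; _∩_; ⁅_⁆; ⋃; ∣_∣; Empty)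
open import Data.Fin.Subset.Properties
  using ( _∈?_; ∉⊥; ∣⊥∣≡0; q⊆p∪q; x∈p∪q⁻; x∈p∪q⁺; x∈p∩q⁺; x∈p∩q⁻; x∈⁅x⁆; x∈⁅y⁆⇒x≡y; ∣⁅x⁆∣≡1
        ; p⊆q⇒∣p∣≤∣q∣)
open import Data.Vec using (_∷_; []; here; there)
open import Data.List using (List; _∷_; []; map; allFin)
open import Data.List.Membership.Propositional using () renaming (_∈_ to _∈ₗ_)
open import Data.List.Membership.Propositional.Properties using (∈-filter⁺; ∈-filter⁻; ∈-allFin)
open import Data.List.Relation.Unary.All as All using ()
open import Data.List.Relation.Unary.AllPairs using (_∷_)
open import Data.List.Relation.Unary.Any using () renaming (here to hereₗ; there to thereₗ)
open import Data.List.Relation.Unary.Unique.Propositional using (Unique)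
open import Data.List.Relation.Unary.Unique.Propositional.Properties using (allFin⁺; filter⁺)
open import Data.Product using (∃; _×_; _,_; proj₁; proj₂)
open import Data.Sum using (_⊎_; inj₁; inj₂)
open import Function using (_∘_)
open import Induction.WellFounded using (Acc; acc)
open import Relation.Nullary using (¬_; Dec; yes; no; does; ¬?; contradiction)
open import Relation.Nullary.Decidable using (_×-dec_)
open import Relation.Unary using (Pred; Decidable)
open import Relation.Binary.PropositionalEquality using (_≡_; _≢_; refl; sym; trans; cong; subst)

subsetOf : ∀ {n ℓ} {P : Pred (Fin n) ℓ} → Decidable P → Subset n
subsetOf {zero}  P? = []
subsetOf {suc n} P? = does (P? zero) ∷ subsetOf (P? ∘ suc)

∈-subsetOf⁺ : ∀ {n ℓ} {P : Pred (Fin n) ℓ} (P? : Decidable P) {x} → P x → x ∈ subsetOf P?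
∈-subsetOf⁺ {suc n} P? {zero} px with P? zero
... | yes _   = here
... | no ¬px  = contradiction px ¬px
∈-subsetOf⁺ {suc n} P? {suc x} px = there (∈-subsetOf⁺ (P? ∘ suc) px)

∈-subsetOf⁻ : ∀ {n ℓ} {P : Pred (Fin n) ℓ} (P? : Decidable P) {x} → x ∈ subsetOf P? → P x
∈-subsetOf⁻ {suc n} P? {zero} x∈ with P? zero | x∈
... | yes px | _ = px
... | no _   | ()
∈-subsetOf⁻ {suc n} P? {suc x} (there x∈) = ∈-subsetOf⁻ (P? ∘ suc) x∈

∣p∪q∣≤∣p∣+∣q∣ : ∀ {n} (p q : Subset n) → ∣ p ∪ q ∣ ≤ ∣ p ∣ + ∣ q ∣
∣p∪q∣≤∣p∣+∣q∣ []            []            = z≤n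
∣p∪q∣≤∣p∣+∣q∣ (inside  ∷ p) (inside  ∷ q) =
  s≤s (≤-trans (m≤n⇒m≤1+n (∣p∪q∣≤∣p∣+∣q∣ p q)) (≤-reflexive (sym (+-suc ∣ p ∣ ∣ q ∣))))
∣p∪q∣≤∣p∣+∣q∣ (inside  ∷ p) (outside ∷ q) = s≤s (∣p∪q∣≤∣p∣+∣q∣ p q)
∣p∪q∣≤∣p∣+∣q∣ (outside ∷ p) (inside  ∷ q) =
  ≤-trans (s≤s (∣p∪q∣≤∣p∣+∣q∣ p q)) (≤-reflexive (sym (+-suc ∣ p ∣ ∣ q ∣)))
∣p∪q∣≤∣p∣+∣q∣ (outside ∷ p) (outside ∷ q) = ∣p∪q∣≤∣p∣+∣q∣ p q

Empty-∩⇒∣p∣+∣q∣≤∣p∪q∣ : ∀ {n} (p q : Subset n) → Empty (p ∩ q) → ∣ p ∣ + ∣ q ∣ ≤ ∣ p ∪ q ∣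
Empty-∩⇒∣p∣+∣q∣≤∣p∪q∣ []      []      _ = z≤n
Empty-∩⇒∣p∣+∣q∣≤∣p∪q∣ (s ∷ p) (t ∷ q) e with Empty-∩⇒∣p∣+∣q∣≤∣p∪q∣ p q (λ (x , x∈) → e (suc x , there x∈))
Empty-∩⇒∣p∣+∣q∣≤∣p∪q∣ (inside  ∷ p) (inside  ∷ q) e | _  = contradiction (zero , here) e
Empty-∩⇒∣p∣+∣q∣≤∣p∪q∣ (inside  ∷ p) (outside ∷ q) e | ih = s≤s ih
Empty-∩⇒∣p∣+∣q∣≤∣p∪q∣ (outside ∷ p) (inside  ∷ q) e | ih = ≤-trans (≤-reflexive (+-suc ∣ p ∣ ∣ q ∣)) (s≤s ih)
Empty-∩⇒∣p∣+∣q∣≤∣p∪q∣ (outside ∷ p) (outside ∷ q) e | ih = ih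

module _ {ℓ} {A : Set ℓ} {n : ℕ} (f : A → Subset n) where

  ∈⋃-map⁺ : ∀ {a x xs} → a ∈ₗ xs → x ∈ f a → x ∈ ⋃ (map f xs)
  ∈⋃-map⁺ (hereₗ refl) x∈ = x∈p∪q⁺ (inj₁ x∈)
  ∈⋃-map⁺ (thereₗ a∈) x∈ = x∈p∪q⁺ (inj₂ (∈⋃-map⁺ a∈ x∈))

  ∈⋃-map⁻ : ∀ {x} xs → x ∈ ⋃ (map f xs) → ∃ λ a → a ∈ₗ xs × x ∈ f a
  ∈⋃-map⁻ []       x∈ = contradiction x∈ ∉⊥
  ∈⋃-map⁻ (a ∷ xs) x∈ with x∈p∪q⁻ (f a) _ x∈
  ... | inj₁ x∈fa = a , hereₗ refl , x∈fa
  ... | inj₂ x∈⋃ with ∈⋃-map⁻ xs x∈⋃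
  ...   | b , b∈ , x∈fb = b , thereₗ b∈ , x∈fb

  ∣⋃-map∣≤sum : ∀ xs → ∣ ⋃ (map f xs) ∣ ≤ sum (map (∣_∣ ∘ f) xs)
  ∣⋃-map∣≤sum []       = ≤-reflexive (∣⊥∣≡0 n)
  ∣⋃-map∣≤sum (a ∷ xs) = ≤-trans (∣p∪q∣≤∣p∣+∣q∣ (f a) _) (+-mono-≤ ≤-refl (∣⋃-map∣≤sum xs))

  sum≤∣⋃-map∣ : ∀ {xs} → Unique xs →
    (∀ {a b} → a ∈ₗ xs → b ∈ₗ xs → a ≢ b → Empty (f a ∩ f b)) →
    sum (map (∣_∣ ∘ f) xs) ≤ ∣ ⋃ (map f xs) ∣
  sum≤∣⋃-map∣ {[]}     _             _        = z≤n
  sum≤∣⋃-map∣ {a ∷ xs} (a∉xs ∷ xs!) disjoint =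
    ≤-trans (+-mono-≤ ≤-refl (sum≤∣⋃-map∣ xs! (λ p q → disjoint (thereₗ p) (thereₗ q))))
            (Empty-∩⇒∣p∣+∣q∣≤∣p∪q∣ (f a) _ apart)
    where
    apart : Empty (f a ∩ ⋃ (map f xs))
    apart (x , x∈) with x∈p∩q⁻ (f a) _ x∈
    ... | x∈fa , x∈⋃ with ∈⋃-map⁻ xs x∈⋃
    ...   | b , b∈ , x∈fb =
      disjoint (hereₗ refl) (thereₗ b∈) (All.lookup a∉xs b∈) (x , x∈p∩q⁺ (x∈fa , x∈fb))

sum-map-mono-≤ : ∀ {ℓ} {A : Set ℓ} {f g : A → ℕ} xs →
  (∀ {x} → x ∈ₗ xs → f x ≤ g x) → sum (map f xs) ≤ sum (map g xs)
sum-map-mono-≤ []       _   = z≤n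
sum-map-mono-≤ (x ∷ xs) f≤g = +-mono-≤ (f≤g (hereₗ refl)) (sum-map-mono-≤ xs (f≤g ∘ thereₗ))

module _ {n : ℕ} (G : RTT n) where
  open RTT G

  Desc⇒depth≤ : ∀ {u x} → Desc G u x → depth u ≤ depth x
  Desc⇒depth≤ here         = ≤-refl
  Desc⇒depth≤ (step x≢r d) = ≤-trans (Desc⇒depth≤ d) (<⇒≤ (depth-par _ x≢r))

  desc? : ∀ u → Decidable (Desc G u)
  desc? u x = go x (<-wellFounded (depth x))
    where
    go : ∀ x → Acc _<_ (depth x) → Dec (Desc G u x)
    go x (acc rec) with x ≟ u
    ... | yes refl = yes here
    ... | no x≢u with x ≟ root
    ...   | yes refl = no λ { here → x≢u refl ; (step x≢r _) → x≢r refl }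
    ...   | no x≢r with go (par x) (rec (depth-par x x≢r))
    ...     | yes d = yes (step x≢r d)
    ...     | no ¬d = no λ { here → x≢u refl ; (step _ d) → ¬d d }

  edgeIn? : ∀ u → Decidable (EdgeIn G u)
  edgeIn? u x = ¬? (x ≟ root) ×-dec desc? u (par x)

  child? : ∀ v → Decidable (Child G v)
  child? v u = ¬? (u ≟ root) ×-dec (par u ≟ v)

  -- Edges are named by their lower endpoint, so nodesOf u is the set of edges
  -- of T_u together with e_u.
  nodesOf : Fin n → Subset n
  nodesOf u = subsetOf (desc? u)

  edgesOf : Fin n → Subset n
  edgesOf u = subsetOf (edgeIn? u)

  EdgeIn⇒Desc : ∀ {u x} → EdgeIn G u x → Desc G u x
  EdgeIn⇒Desc (x≢r , d) = step x≢r d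

  Desc⇒≡⊎EdgeIn : ∀ {u x} → Desc G u x → x ≡ u ⊎ EdgeIn G u x
  Desc⇒≡⊎EdgeIn here         = inj₁ refl
  Desc⇒≡⊎EdgeIn (step x≢r d) = inj₂ (x≢r , d)

  Child⇒¬Desc : ∀ {v w} → Child G v w → ¬ Desc G w v
  Child⇒¬Desc {w = w} (w≢r , refl) d = <⇒≱ (depth-par w w≢r) (Desc⇒depth≤ d)

  Desc-child⇒≡ : ∀ {v w u} → Child G v w → Child G v u → Desc G w u → w ≡ u
  Desc-child⇒≡ _   _            here       = refl
  Desc-child⇒≡ c-w (_ , refl) (step _ d) = contradiction d (Child⇒¬Desc c-w)

  Desc-comparable : ∀ {a b x} → Desc G a x → Desc G b x → Desc G a b ⊎ Desc G b a
  Desc-comparable here         d₂           = inj₂ d₂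
  Desc-comparable (step x≢r d₁) here        = inj₁ (step x≢r d₁)
  Desc-comparable (step _ d₁)  (step _ d₂) = Desc-comparable d₁ d₂

  Desc-children⇒≡ : ∀ {v u w x} → Child G v u → Child G v w → Desc G u x → Desc G w x → u ≡ w
  Desc-children⇒≡ c-u c-w d-u d-w with Desc-comparable d-u d-w
  ... | inj₁ u→w = Desc-child⇒≡ c-u c-w u→w
  ... | inj₂ w→u = sym (Desc-child⇒≡ c-w c-u w→u)

  EdgeIn⇒∃Child : ∀ {v x} → EdgeIn G v x → ∃ λ u → Child G v u × Desc G u x
  EdgeIn⇒∃Child (x≢r , d) = go d _ x≢r refl
    where
    go : ∀ {v y} → Desc G v y → ∀ x → x ≢ root → par x ≡ y → ∃ λ u → Child G v u × Desc G u x
    go here         x x≢r px≡y = x , (x≢r , px≡y) , here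
    go (step y≢r d) x x≢r refl with go d _ y≢r refl
    ... | u , c , d-u = u , c , step x≢r d-u

  -- The endpoints of an edge of T_w lie in T_w, while e_u = {u , v} meets T_w
  -- only if u = w.
  ShareEnd-children⇒≡ : ∀ {v w u y} → Child G v w → Child G v u → EdgeIn G w y → ShareEnd G y u → w ≡ u
  ShareEnd-children⇒≡ c-w c-u e (inj₁ refl) = Desc-child⇒≡ c-w c-u (EdgeIn⇒Desc e)
  ShareEnd-children⇒≡ c-w (_ , refl) e (inj₂ (inj₁ refl)) = contradiction (EdgeIn⇒Desc e) (Child⇒¬Desc c-w)
  ShareEnd-children⇒≡ c-w c-u (_ , d) (inj₂ (inj₂ (inj₁ refl))) = Desc-child⇒≡ c-w c-u d
  ShareEnd-children⇒≡ c-w (_ , pu≡v) (_ , d) (inj₂ (inj₂ (inj₂ py≡pu))) =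
    contradiction (subst (Desc G _) (trans py≡pu pu≡v) d) (Child⇒¬Desc c-w)

  ShareEnd-sym : ∀ {x y} → ShareEnd G x y → ShareEnd G y x
  ShareEnd-sym (inj₁ e)               = inj₁ (sym e)
  ShareEnd-sym (inj₂ (inj₁ e))        = inj₂ (inj₂ (inj₁ (sym e)))
  ShareEnd-sym (inj₂ (inj₂ (inj₁ e))) = inj₂ (inj₁ (sym e))
  ShareEnd-sym (inj₂ (inj₂ (inj₂ e))) = inj₂ (inj₂ (inj₂ (sym e)))

  Overlap-sym : ∀ {x y} → Overlap G x y → Overlap G y x
  Overlap-sym (x≢y , share , t , act-x , act-y) = x≢y ∘ sym , ShareEnd-sym share , t , act-y , act-x

  IsTimedMatchingOf-⊆ : ∀ {u S T} → S ⊆ T → IsTimedMatchingOf G u T → IsTimedMatchingOf G u S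
  IsTimedMatchingOf-⊆ S⊆T (edges , apart) = (λ x → edges x ∘ S⊆T) , λ x y x∈ y∈ → apart x y (S⊆T x∈) (S⊆T y∈)

  ∈children⇒Child : ∀ {v u} → u ∈ₗ children G v → Child G v u
  ∈children⇒Child {v} u∈ = proj₂ (∈-filter⁻ (child? v) {xs = allFin n} u∈)

  Child⇒∈children : ∀ {v u} → Child G v u → u ∈ₗ children G v
  Child⇒∈children {v} {u} c = ∈-filter⁺ (child? v) (∈-allFin u) c

  children-unique : ∀ v → Unique (children G v)
  children-unique v = filter⁺ (child? v) (allFin⁺ n)

  module _ {v : Fin n} {M : Fin n → Subset n}
           (M-max : ∀ u → Child G v u → IsMaxTimedMatchingOf G u (M u)) where

    ∈M⇒EdgeIn : ∀ {u x} → Child G v u → x ∈ M u → EdgeIn G u x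
    ∈M⇒EdgeIn c x∈ = proj₁ (proj₁ (M-max _ c)) _ x∈

    M-disjoint : ∀ {u w} → u ∈ₗ children G v → w ∈ₗ children G v → u ≢ w → Empty (M u ∩ M w)
    M-disjoint u∈ w∈ u≢w (x , x∈) with x∈p∩q⁻ (M _) (M _) x∈
    ... | x∈Mu , x∈Mw = u≢w (Desc-children⇒≡ c-u c-w (EdgeIn⇒Desc (∈M⇒EdgeIn c-u x∈Mu))
                                                      (EdgeIn⇒Desc (∈M⇒EdgeIn c-w x∈Mw)))
      where
      c-u : Child G v _
      c-u = ∈children⇒Child u∈
      c-w : Child G v _
      c-w = ∈children⇒Child w∈

    ∈TM1⁻ : ∀ {y} → y ∈ TM1 G M v → ∃ λ w → Child G v w × y ∈ M w
    ∈TM1⁻ y∈ with ∈⋃-map⁻ M (children G v) y∈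
    ... | w , w∈ , y∈Mw = w , ∈children⇒Child w∈ , y∈Mw

    ⁅⁆-allowable : ∀ {u} → IsTimedMatchingOf G v (TM1 G M v) → Child G v u →
      (∀ x → ¬ InRemovalSet G (M u) u x) → IsAllowable G M v ⁅ u ⁆
    ⁅⁆-allowable {u} (TM1-edges , TM1-apart) c-u@(u≢r , pu≡v) M-avoids =
      (λ x x∈ → subst (Child G v) (sym (x∈⁅y⁆⇒x≡y u x∈)) c-u) , edges , apart
      where
      split : ∀ {x} → x ∈ ⁅ u ⁆ ∪ TM1 G M v → x ≡ u ⊎ x ∈ TM1 G M v
      split x∈ with x∈p∪q⁻ ⁅ u ⁆ _ x∈
      ... | inj₁ x∈⁅u⁆ = inj₁ (x∈⁅y⁆⇒x≡y u x∈⁅u⁆)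
      ... | inj₂ x∈TM1 = inj₂ x∈TM1

      -- Only M_u can meet e_u, and it does not.
      TM1-avoids : ∀ {y} → y ∈ TM1 G M v → ¬ Overlap G y u
      TM1-avoids y∈ ov with ∈TM1⁻ y∈
      ... | w , c-w , y∈Mw with ShareEnd-children⇒≡ c-w c-u (∈M⇒EdgeIn c-w y∈Mw) (proj₁ (proj₂ ov))
      ...   | refl = M-avoids _ (y∈Mw , ov)

      edges : ∀ x → x ∈ ⁅ u ⁆ ∪ TM1 G M v → EdgeIn G v x
      edges x x∈ with split x∈
      ... | inj₁ refl  = u≢r , subst (Desc G v) (sym pu≡v) here
      ... | inj₂ x∈TM1 = TM1-edges x x∈TM1

      apart : NoOverlap G (⁅ u ⁆ ∪ TM1 G M v)
      apart x y x∈ y∈ with split x∈ | split y∈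
      ... | inj₁ refl  | inj₁ refl  = λ ov → proj₁ ov refl
      ... | inj₁ refl  | inj₂ y∈TM1 = TM1-avoids y∈TM1 ∘ Overlap-sym
      ... | inj₂ x∈TM1 | inj₁ refl  = TM1-avoids x∈TM1
      ... | inj₂ x∈TM1 | inj₂ y∈TM1 = TM1-apart x y x∈TM1 y∈TM1

    module ChildParts
      (M-saturated : ∀ u → Child G v u → ¬ (∃ λ M' → IsTimedMatchingOf G u M' × ∣ M' ∣ ≡ ∣ M u ∣ ×
          (∀ x → ¬ InRemovalSet G M' u x) × (∃ λ x → InRemovalSet G (M u) u x)))
      {F : Subset n} (F-max : IsMaxAllowable G M v F) (∣F∣≡0 : ∣ F ∣ ≡ 0)
      {Mt : Subset n} (Mt-matching : IsTimedMatchingOf G v Mt) where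

      Mt-apart : NoOverlap G Mt
      Mt-apart = proj₂ Mt-matching

      ∩⊆Mt : ∀ {p x} → x ∈ Mt ∩ p → x ∈ Mt
      ∩⊆Mt x∈ = proj₁ (x∈p∩q⁻ Mt _ x∈)

      Mt∩edgesOf-matching : ∀ u → IsTimedMatchingOf G u (Mt ∩ edgesOf u)
      Mt∩edgesOf-matching u =
        (λ x x∈ → ∈-subsetOf⁻ (edgeIn? u) (proj₂ (x∈p∩q⁻ Mt _ x∈))) ,
        (λ x y x∈ y∈ → Mt-apart x y (∩⊆Mt x∈) (∩⊆Mt y∈))

      ∣Mt∩edgesOf∣≤∣M∣ : ∀ {u} → Child G v u → ∣ Mt ∩ edgesOf u ∣ ≤ ∣ M u ∣
      ∣Mt∩edgesOf∣≤∣M∣ {u} c = proj₂ (M-max u c) _ (Mt∩edgesOf-matching u)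

      ∣Mt∩edgesOf∣≢∣M∣ : ∀ {u} → Child G v u → u ∈ Mt → ∣ Mt ∩ edgesOf u ∣ ≢ ∣ M u ∣
      ∣Mt∩edgesOf∣≢∣M∣ {u} c u∈Mt eq = 1+n≰n (begin
        1           ≡⟨ sym (∣⁅x⁆∣≡1 u) ⟩
        ∣ ⁅ u ⁆ ∣   ≤⟨ proj₂ F-max ⁅ u ⁆ (⁅⁆-allowable TM1-matching c M-avoids) ⟩
        ∣ F ∣       ≡⟨ ∣F∣≡0 ⟩
        0           ∎)
        where
        open ≤-Reasoning
        Mt∩edgesOf-avoids : ∀ x → ¬ InRemovalSet G (Mt ∩ edgesOf u) u x
        Mt∩edgesOf-avoids x (x∈ , ov) = Mt-apart x u (∩⊆Mt x∈) u∈Mt ov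
        M-avoids : ∀ x → ¬ InRemovalSet G (M u) u x
        M-avoids x r = M-saturated u c (_ , Mt∩edgesOf-matching u , eq , Mt∩edgesOf-avoids , x , r)
        TM1-matching : IsTimedMatchingOf G v (TM1 G M v)
        TM1-matching = IsTimedMatchingOf-⊆ (q⊆p∪q F _) (proj₂ (proj₁ F-max))

      ∣Mt∩nodesOf∣≤∣M∣ : ∀ {u} → Child G v u → ∣ Mt ∩ nodesOf u ∣ ≤ ∣ M u ∣
      ∣Mt∩nodesOf∣≤∣M∣ {u} c with u ∈? Mt
      ... | no u∉Mt = ≤-trans (p⊆q⇒∣p∣≤∣q∣ ⊆Mt∩edgesOf) (∣Mt∩edgesOf∣≤∣M∣ c)
        where
        ⊆Mt∩edgesOf : Mt ∩ nodesOf u ⊆ Mt ∩ edgesOf u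
        ⊆Mt∩edgesOf x∈ with x∈p∩q⁻ Mt _ x∈
        ... | x∈Mt , x∈nodes with Desc⇒≡⊎EdgeIn (∈-subsetOf⁻ (desc? u) x∈nodes)
        ...   | inj₁ refl = contradiction x∈Mt u∉Mt
        ...   | inj₂ e    = x∈p∩q⁺ (x∈Mt , ∈-subsetOf⁺ (edgeIn? u) e)
      ... | yes u∈Mt = begin
        ∣ Mt ∩ nodesOf u ∣                ≤⟨ p⊆q⇒∣p∣≤∣q∣ ⊆Mt∩edgesOf∪⁅u⁆ ⟩
        ∣ (Mt ∩ edgesOf u) ∪ ⁅ u ⁆ ∣      ≤⟨ ∣p∪q∣≤∣p∣+∣q∣ (Mt ∩ edgesOf u) ⁅ u ⁆ ⟩
        ∣ Mt ∩ edgesOf u ∣ + ∣ ⁅ u ⁆ ∣    ≡⟨ trans (cong (∣ Mt ∩ edgesOf u ∣ +_) (∣⁅x⁆∣≡1 u)) (+-comm _ 1) ⟩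
        suc ∣ Mt ∩ edgesOf u ∣            ≤⟨ ≤∧≢⇒< (∣Mt∩edgesOf∣≤∣M∣ c) (∣Mt∩edgesOf∣≢∣M∣ c u∈Mt) ⟩
        ∣ M u ∣                           ∎
        where
        open ≤-Reasoning
        ⊆Mt∩edgesOf∪⁅u⁆ : Mt ∩ nodesOf u ⊆ (Mt ∩ edgesOf u) ∪ ⁅ u ⁆
        ⊆Mt∩edgesOf∪⁅u⁆ x∈ with x∈p∩q⁻ Mt _ x∈
        ... | x∈Mt , x∈nodes with Desc⇒≡⊎EdgeIn (∈-subsetOf⁻ (desc? u) x∈nodes)
        ...   | inj₁ refl = x∈p∪q⁺ (inj₂ (x∈⁅x⁆ u))
        ...   | inj₂ e    = x∈p∪q⁺ (inj₁ (x∈p∩q⁺ (x∈Mt , ∈-subsetOf⁺ (edgeIn? u) e)))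

      Mt-covered : Mt ⊆ ⋃ (map (λ u → Mt ∩ nodesOf u) (children G v))
      Mt-covered x∈ with EdgeIn⇒∃Child (proj₁ Mt-matching _ x∈)
      ... | u , c , d = ∈⋃-map⁺ (λ u → Mt ∩ nodesOf u) (Child⇒∈children c)
                                (x∈p∩q⁺ (x∈ , ∈-subsetOf⁺ (desc? u) d))

lemma1 : ∀ {n} (G : RTT n) (v : Fin n) (M : Fin n → Subset n) →
    (∃ λ u → Child G v u) →
    (∀ u → Child G v u → IsMaxTimedMatchingOf G u (M u)) →
    (∀ u → Child G v u → ¬ (∃ λ M' → IsTimedMatchingOf G u M' × ∣ M' ∣ ≡ ∣ M u ∣ ×
        (∀ x → ¬ InRemovalSet G M' u x) × (∃ λ x → InRemovalSet G (M u) u x))) →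
    (F : Subset n) → IsMaxFeasible G M v F → ∣ F ∣ ≡ 0 →
    (Mt : Subset n) → IsMaxIncidentMatching G v Mt →
    ∣ Mt ∣ ≤ ∣ TM1 G M v ∣
lemma1 G v M _ M-max M-saturated F (F-max , _) ∣F∣≡0 Mt ((Mt-matching , _) , _) = begin
  ∣ Mt ∣                        ≤⟨ p⊆q⇒∣p∣≤∣q∣ Mt-covered ⟩
  ∣ ⋃ (map part L) ∣            ≤⟨ ∣⋃-map∣≤sum part L ⟩
  sum (map (∣_∣ ∘ part) L)      ≤⟨ sum-map-mono-≤ L (∣Mt∩nodesOf∣≤∣M∣ ∘ ∈children⇒Child G) ⟩
  sum (map (∣_∣ ∘ M) L)         ≤⟨ sum≤∣⋃-map∣ M (children-unique G v) (M-disjoint G M-max) ⟩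
  ∣ TM1 G M v ∣                 ∎
  where
  open ChildParts G M-max M-saturated F-max ∣F∣≡0 Mt-matching
  open ≤-Reasoning
  L : List (Fin _)
  L = children G v
  part : Fin _ → Subset _
  part u = Mt ∩ nodesOf G u
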